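{- Let $\delta$ be a primitive element of $\mathbb{F}_9$ and let $\alpha\in\mathbb{F}_{81}$ satisfy $\alpha^2=\delta$, chosen such that $\{x\in\mathbb{F}_9 : x+\alpha \text{ is a nonzero square in } \mathbb{F}_{81}\}=\{\delta,\delta^2,\delta^5,\delta^6\}$. Let $H=\{1,\delta\}$ and $C_9=\{0\}\cup H\cup(\alpha+\delta^5)H$. For $s\in S$, $\gamma\in\mathbb{F}_{81}$ and $\eta\in\{1,3\}$ put $C^{\eta}_{s,\gamma}=\{s x^{\eta}+\gamma : x\in C_9\}$. Then the orbit $\mathcal{C}_9$ of $C_9$ under $\mathrm{Aut}(P(9^2))$ equals $\{C^{1}_{s,\gamma}: s\in S,\gamma\in\mathbb{F}_{81}\}\cup\{C^{3}_{s,\gamma}: s\in S,\gamma\in\mathbb{F}_{81}\}$.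
   Context: $S$ denotes the set of nonzero squares of $\mathbb{F}_{81}$. The Paley graph $P(9^2)$ has vertex set $\mathbb{F}_{81}$, two distinct vertices adjacent iff their difference lies in $S$. Its automorphism group is $\mathrm{Aut}(P(9^2))=\{\gamma\mapsto a\gamma^{v}+b : a\in S,\ b\in\mathbb{F}_{81},\ v\in\mathrm{Gal}(\mathbb{F}_{81})\}$, acting on subsets of $\mathbb{F}_{81}$ elementwise. -}

module Defs where

open import Data.Nat using (ℕ; zero; suc)
open import Data.Fin using (Fin; toℕ)
open import Data.Product using (Σ; ∃; _×_; _,_)
open import Data.Sum using (_⊎_)
open import Level using (0ℓ)
open import Relation.Nullary using (¬_)
open import Relation.Unary using (Pred)
open import Relation.Binary.PropositionalEquality using (_≡_)

data F3 : Set where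
  o0 o1 o2 : F3

_+₃_ : F3 → F3 → F3
o0 +₃ y = y
o1 +₃ o0 = o1
o1 +₃ o1 = o2
o1 +₃ o2 = o0
o2 +₃ o0 = o2
o2 +₃ o1 = o0
o2 +₃ o2 = o1

_*₃_ : F3 → F3 → F3
o0 *₃ y = o0
o1 *₃ y = y
o2 *₃ o0 = o0
o2 *₃ o1 = o2
o2 *₃ o2 = o1

-- The field F₈₁ = F₃[t]/(t⁴ + 2t³ + 2)  (Conway polynomial, irreducible)
-- An element  mk c0 c1 c2 c3  represents c0 + c1 t + c2 t² + c3 t³.
-- Reduction rule: t⁴ = t³ + 1.

record F81 : Set where
  constructor mk
  field
    c0 c1 c2 c3 : F3

0F : F81
0F = mk o0 o0 o0 o0

1F : F81
1F = mk o1 o0 o0 o0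

_+_ : F81 → F81 → F81
mk a0 a1 a2 a3 + mk b0 b1 b2 b3 = mk (a0 +₃ b0) (a1 +₃ b1) (a2 +₃ b2) (a3 +₃ b3)

infixl 6 _+_
infixl 7 _*_
infixr 8 _^_

-- multiplication by t, reducing t⁴ = t³ + 1
mulT : F81 → F81
mulT (mk a0 a1 a2 a3) = mk a3 a0 a1 (a2 +₃ a3)

scale : F3 → F81 → F81
scale c (mk a0 a1 a2 a3) = mk (c *₃ a0) (c *₃ a1) (c *₃ a2) (c *₃ a3)

_*_ : F81 → F81 → F81
mk a0 a1 a2 a3 * y =
  scale a0 y + mulT (scale a1 y + mulT (scale a2 y + mulT (scale a3 y)))

_^_ : F81 → ℕ → F81
x ^ zero = 1F
x ^ suc n = x * x ^ n

S : Pred F81 0ℓ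
S x = ¬ (x ≡ 0F) × ∃ λ y → y * y ≡ x

InF9 : Pred F81 0ℓ
InF9 x = x ^ 9 ≡ x

PrimitiveF9 : Pred F81 0ℓ
PrimitiveF9 δ = InF9 δ × (∀ x → InF9 x → ¬ (x ≡ 0F) → ∃ λ (k : ℕ) → δ ^ k ≡ x)

-- Gal(F₈₁) = {x ↦ x^(3^k) : k = 0,1,2,3} (powers of Frobenius)
frob : Fin 4 → F81 → F81
frob k x = x ^ (3 Data.Nat.^ toℕ k)

Img : (F81 → F81) → Pred F81 0ℓ → Pred F81 0ℓ
Img f P y = ∃ λ x → P x × y ≡ f x

-- C₉ = {0} ∪ H ∪ (α + δ⁵)H, with H = {1, δ}
C9 : F81 → F81 → Pred F81 0ℓ
C9 δ α x = x ≡ 0F ⊎ x ≡ 1F ⊎ x ≡ δ ⊎ x ≡ (α + δ ^ 5) * 1F ⊎ x ≡ (α + δ ^ 5) * δ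

Cη : F81 → F81 → ℕ → F81 → F81 → Pred F81 0ℓ
Cη δ α η s γ = Img (λ x → s * x ^ η + γ) (C9 δ α)

{-# OPTIONS --safe #-}
-- For v ∈ {0, 1} the set a·frob v (C₉) + b already is C^η_{a,b} with η = 3^v, so everything rests
-- on the Frobenius maps φ(x) = x⁹ and x ↦ x²⁷. Write u = α + δ⁵, so that C₉ = {0, 1, δ, u, uδ}.
-- The hypothesis at x = δ⁵ says u ∈ S, and a finite search over α shows that it can only hold
-- when δ² = δ + 1. As α ∉ F₉ we have φ(α) = −α, hence u·φ(u) = δ¹⁰ − α² = δ² − δ = 1; since φ
-- fixes 0, 1, δ ∈ F₉, it maps C₉ onto φ(u)·C₉, and x ↦ x²⁷ = φ(x)³ maps C₉ onto u²⁷·C₉³.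
-- Both factors are powers of u, hence in S, so composing with γ ↦ aγ + b lands in C¹ resp. C³.
module Submission where

open import Defs
open import Data.Nat using (ℕ)
open import Data.Fin using (Fin)
open import Data.Product using (Σ; ∃; _×_; _,_)
open import Data.Sum using (_⊎_)
open import Level using (0ℓ)
open import Relation.Unary using (Pred; _≐_)
open import Relation.Binary.PropositionalEquality using (_≡_)
open import Function.Bundles using (_⇔_)

import Data.Nat as ℕ
open import Data.Fin using (zero; suc; toℕ)
import Data.Fin.Properties as Fin
open import Data.Product using (proj₁; proj₂)
open import Data.Sum using (inj₁; inj₂)
open import Data.Empty using (⊥-elim)
open import Data.List using (List; []; _∷_; map; cartesianProduct; cartesianProductWith)
open import Data.List.Membership.Propositional using (_∈_; lose)
open import Data.List.Membership.Propositional.Properties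
  using (∈-map⁺; ∈-map⁻; ∈-cartesianProduct⁺; ∈-cartesianProductWith⁺)
open import Data.List.Relation.Unary.Any using (here; there; any?; satisfied)
import Data.List.Relation.Unary.All as All
open import Function.Base using (_∘_; case_of_)
open import Function.Bundles using (Equivalence; mk⇔)
open import Relation.Nullary using (¬_; Dec; yes; no)
open import Relation.Nullary.Decidable using (map′; from-yes; ¬?; _×-dec_; _⊎-dec_; _→-dec_)
open import Relation.Unary using (Decidable; _⊆_)
open import Relation.Unary.Properties using (≐-sym; ≐-trans)
open import Relation.Binary.Definitions using (DecidableEquality)
open import Relation.Binary.PropositionalEquality using (refl; sym; cong; cong₂; subst; _≗_)
open import Relation.Binary.PropositionalEquality using (module ≡-Reasoning)

module Enumeration {A : Set} {xs : List A} (complete : ∀ x → x ∈ xs) where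

  ∀? : {P : Pred A 0ℓ} → Decidable P → Dec (∀ x → P x)
  ∀? P? = map′ (λ all x → All.lookup all (complete x)) (λ ∀P → All.tabulate λ {x} _ → ∀P x)
               (All.all? P? xs)

  ∃? : {P : Pred A 0ℓ} → Decidable P → Dec (∃ P)
  ∃? P? = map′ satisfied (λ (x , px) → lose (complete x) px) (any? P? xs)

infix 4 _≟₃_ _≟_

_≟₃_ : DecidableEquality F3
o0 ≟₃ o0 = yes refl
o1 ≟₃ o1 = yes refl
o2 ≟₃ o2 = yes refl
o0 ≟₃ o1 = no λ ()
o0 ≟₃ o2 = no λ ()
o1 ≟₃ o0 = no λ ()
o1 ≟₃ o2 = no λ ()
o2 ≟₃ o0 = no λ ()
o2 ≟₃ o1 = no λ ()

_≟_ : DecidableEquality F81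
mk a0 a1 a2 a3 ≟ mk b0 b1 b2 b3 =
  map′ (λ { (refl , refl , refl , refl) → refl }) (λ { refl → refl , refl , refl , refl })
       (a0 ≟₃ b0 ×-dec a1 ≟₃ b1 ×-dec a2 ≟₃ b2 ×-dec a3 ≟₃ b3)

allF3 : List F3
allF3 = o0 ∷ o1 ∷ o2 ∷ []

∈-allF3 : ∀ c → c ∈ allF3
∈-allF3 o0 = here refl
∈-allF3 o1 = there (here refl)
∈-allF3 o2 = there (there (here refl))

mkFromPairs : F3 × F3 → F3 × F3 → F81
mkFromPairs (a0 , a1) (a2 , a3) = mk a0 a1 a2 a3

allF81 : List F81
allF81 = cartesianProductWith mkFromPairs (cartesianProduct allF3 allF3) (cartesianProduct allF3 allF3)

∈-allF81 : ∀ x → x ∈ allF81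
∈-allF81 (mk a0 a1 a2 a3) = ∈-cartesianProductWith⁺ mkFromPairs
  (∈-cartesianProduct⁺ (∈-allF3 a0) (∈-allF3 a1)) (∈-cartesianProduct⁺ (∈-allF3 a2) (∈-allF3 a3))

open Enumeration ∈-allF3 using () renaming (∀? to ∀₃?)
open Enumeration ∈-allF81 using (∀?; ∃?)

+₃-comm : ∀ x y → x +₃ y ≡ y +₃ x
+₃-comm = from-yes (∀₃? λ x → ∀₃? λ y → x +₃ y ≟₃ y +₃ x)

+₃-interchange : ∀ w x y z → (w +₃ x) +₃ (y +₃ z) ≡ (w +₃ y) +₃ (x +₃ z)
+₃-interchange = from-yes (∀₃? λ w → ∀₃? λ x → ∀₃? λ y → ∀₃? λ z →
  (w +₃ x) +₃ (y +₃ z) ≟₃ (w +₃ y) +₃ (x +₃ z))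

*₃-distribˡ-+₃ : ∀ c x y → c *₃ (x +₃ y) ≡ (c *₃ x) +₃ (c *₃ y)
*₃-distribˡ-+₃ = from-yes (∀₃? λ c → ∀₃? λ x → ∀₃? λ y → c *₃ (x +₃ y) ≟₃ (c *₃ x) +₃ (c *₃ y))

*₃-swap : ∀ c d x → c *₃ (d *₃ x) ≡ d *₃ (c *₃ x)
*₃-swap = from-yes (∀₃? λ c → ∀₃? λ d → ∀₃? λ x → c *₃ (d *₃ x) ≟₃ d *₃ (c *₃ x))

mk-cong : ∀ {a0 a1 a2 a3 b0 b1 b2 b3} →
  a0 ≡ b0 → a1 ≡ b1 → a2 ≡ b2 → a3 ≡ b3 → mk a0 a1 a2 a3 ≡ mk b0 b1 b2 b3
mk-cong refl refl refl refl = refl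

+-comm : ∀ x y → x + y ≡ y + x
+-comm (mk a0 a1 a2 a3) (mk b0 b1 b2 b3) =
  mk-cong (+₃-comm a0 b0) (+₃-comm a1 b1) (+₃-comm a2 b2) (+₃-comm a3 b3)

+-interchange : ∀ w x y z → (w + x) + (y + z) ≡ (w + y) + (x + z)
+-interchange (mk a0 a1 a2 a3) (mk b0 b1 b2 b3) (mk c0 c1 c2 c3) (mk d0 d1 d2 d3) =
  mk-cong (+₃-interchange a0 b0 c0 d0) (+₃-interchange a1 b1 c1 d1)
          (+₃-interchange a2 b2 c2 d2) (+₃-interchange a3 b3 c3 d3)

scale-+ : ∀ c y z → scale c (y + z) ≡ scale c y + scale c z
scale-+ c (mk a0 a1 a2 a3) (mk b0 b1 b2 b3) =
  mk-cong (*₃-distribˡ-+₃ c a0 b0) (*₃-distribˡ-+₃ c a1 b1)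
          (*₃-distribˡ-+₃ c a2 b2) (*₃-distribˡ-+₃ c a3 b3)

scale-scale : ∀ c d y → scale c (scale d y) ≡ scale d (scale c y)
scale-scale c d (mk a0 a1 a2 a3) =
  mk-cong (*₃-swap c d a0) (*₃-swap c d a1) (*₃-swap c d a2) (*₃-swap c d a3)

scale-mulT : ∀ c y → scale c (mulT y) ≡ mulT (scale c y)
scale-mulT c (mk a0 a1 a2 a3) = mk-cong refl refl refl (*₃-distribˡ-+₃ c a2 a3)

mulT-+ : ∀ y z → mulT (y + z) ≡ mulT y + mulT z
mulT-+ (mk a0 a1 a2 a3) (mk b0 b1 b2 b3) = mk-cong refl refl refl (+₃-interchange a2 b2 a3 b3)

-- Multiplication is Horner's scheme in the coefficients of x with t acting as mulT:
-- mk c₀ c₁ c₂ c₃ * y = horner c₀ (c₁ ∷ c₂ ∷ c₃ ∷ []) y definitionally. Hence x * _ commutes with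
-- every F₃[t]-linear map, and being F₃[t]-linear itself, with every y * _.
horner : F3 → List F3 → F81 → F81
horner c []        y = scale c y
horner c (c′ ∷ cs) y = scale c y + mulT (horner c′ cs y)

record F₃[t]-Linear (L : F81 → F81) : Set where
  field
    additive : ∀ y z → L (y + z) ≡ L y + L z
    scale-comm : ∀ c y → L (scale c y) ≡ scale c (L y)
    mulT-comm : ∀ y → L (mulT y) ≡ mulT (L y)

F₃[t]-linear-horner : ∀ {L} → F₃[t]-Linear L → ∀ c cs y → L (horner c cs y) ≡ horner c cs (L y)
F₃[t]-linear-horner lin c [] y = F₃[t]-Linear.scale-comm lin c y
F₃[t]-linear-horner {L} lin c (c′ ∷ cs) y = begin
  L (scale c y + mulT (horner c′ cs y))      ≡⟨ additive (scale c y) (mulT (horner c′ cs y)) ⟩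
  L (scale c y) + L (mulT (horner c′ cs y))  ≡⟨ cong₂ _+_ (scale-comm c y) (mulT-comm (horner c′ cs y)) ⟩
  scale c (L y) + mulT (L (horner c′ cs y))  ≡⟨ cong (λ w → scale c (L y) + mulT w)
                                                      (F₃[t]-linear-horner lin c′ cs y) ⟩
  scale c (L y) + mulT (horner c′ cs (L y))  ∎
  where
  open F₃[t]-Linear lin
  open ≡-Reasoning

F₃[t]-linear-*-comm : ∀ {L} → F₃[t]-Linear L → ∀ x y → L (x * y) ≡ x * L y
F₃[t]-linear-*-comm lin (mk a0 a1 a2 a3) = F₃[t]-linear-horner lin a0 (a1 ∷ a2 ∷ a3 ∷ [])

horner-+ : ∀ c cs y z → horner c cs (y + z) ≡ horner c cs y + horner c cs z
horner-+ c [] y z = scale-+ c y z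
horner-+ c (c′ ∷ cs) y z = begin
  scale c (y + z) + mulT (horner c′ cs (y + z))
    ≡⟨ cong₂ _+_ (scale-+ c y z) (cong mulT (horner-+ c′ cs y z)) ⟩
  (scale c y + scale c z) + mulT (p + q)
    ≡⟨ cong (scale c y + scale c z +_) (mulT-+ p q) ⟩
  (scale c y + scale c z) + (mulT p + mulT q)
    ≡⟨ +-interchange (scale c y) (scale c z) (mulT p) (mulT q) ⟩
  (scale c y + mulT p) + (scale c z + mulT q) ∎
  where
  open ≡-Reasoning
  p q : F81
  p = horner c′ cs y
  q = horner c′ cs z

*-distribˡ-+ : ∀ x y z → x * (y + z) ≡ x * y + x * z
*-distribˡ-+ (mk a0 a1 a2 a3) = horner-+ a0 (a1 ∷ a2 ∷ a3 ∷ [])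

scale-linear : ∀ c → F₃[t]-Linear (scale c)
scale-linear c = record
  { additive = scale-+ c ; scale-comm = λ d y → scale-scale c d y ; mulT-comm = scale-mulT c }

mulT-linear : F₃[t]-Linear mulT
mulT-linear = record
  { additive = mulT-+ ; scale-comm = λ c y → sym (scale-mulT c y) ; mulT-comm = λ _ → refl }

*-linear : ∀ x → F₃[t]-Linear (x *_)
*-linear x = record
  { additive = *-distribˡ-+ x
  ; scale-comm = λ c y → sym (F₃[t]-linear-*-comm (scale-linear c) x y)
  ; mulT-comm = λ y → sym (F₃[t]-linear-*-comm mulT-linear x y)
  }

*-swap : ∀ x y z → x * (y * z) ≡ y * (x * z)
*-swap x = F₃[t]-linear-*-comm (*-linear x)

*-identityʳ : ∀ x → x * 1F ≡ x
*-identityʳ = from-yes (∀? λ x → x * 1F ≟ x)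

*-comm : ∀ x y → x * y ≡ y * x
*-comm x y = begin
  x * y         ≡⟨ cong (x *_) (*-identityʳ y) ⟨
  x * (y * 1F)  ≡⟨ *-swap x y 1F ⟩
  y * (x * 1F)  ≡⟨ cong (y *_) (*-identityʳ x) ⟩
  y * x         ∎
  where open ≡-Reasoning

*-assoc : ∀ x y z → (x * y) * z ≡ x * (y * z)
*-assoc x y z = begin
  (x * y) * z  ≡⟨ *-comm (x * y) z ⟩
  z * (x * y)  ≡⟨ *-swap z x y ⟩
  x * (z * y)  ≡⟨ cong (x *_) (*-comm z y) ⟩
  x * (y * z)  ∎
  where open ≡-Reasoning

*-nonzero : ∀ x y → ¬ x ≡ 0F → ¬ y ≡ 0F → ¬ x * y ≡ 0F
*-nonzero = from-yes (∀? λ x → ∀? λ y → ¬? (x ≟ 0F) →-dec ¬? (y ≟ 0F) →-dec ¬? (x * y ≟ 0F))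

S? : Decidable S
S? z = ¬? (z ≟ 0F) ×-dec ∃? (λ y → y * y ≟ z)

InF9? : Decidable InF9
InF9? x = x ^ 9 ≟ x

S-* : ∀ {x y} → S x → S y → S (x * y)
S-* {x} {y} (x≢0 , r , r²≡x) (y≢0 , q , q²≡y) = *-nonzero x y x≢0 y≢0 , r * q , (begin
  (r * q) * (r * q)  ≡⟨ *-assoc r q (r * q) ⟩
  r * (q * (r * q))  ≡⟨ cong (r *_) (*-swap q r q) ⟩
  r * (r * (q * q))  ≡⟨ *-assoc r r (q * q) ⟨
  (r * r) * (q * q)  ≡⟨ cong₂ _*_ r²≡x q²≡y ⟩
  x * y              ∎)
  where open ≡-Reasoning

S-^ : ∀ {x} → S x → ∀ n → S (x ^ n)
S-^ Sx ℕ.zero    = (λ ()) , 1F , refl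
S-^ Sx (ℕ.suc n) = S-* Sx (S-^ Sx n)

Img-cong : ∀ {f g} {P : Pred F81 0ℓ} → f ≗ g → Img f P ≐ Img g P
Img-cong f≗g = (λ { (x , px , refl) → x , px , f≗g x }) ,
                (λ { (x , px , refl) → x , px , sym (f≗g x) })

Img-∘-cong : ∀ {f g} (h : F81 → F81) {P : Pred F81 0ℓ} →
  Img f P ≐ Img g P → Img (h ∘ f) P ≐ Img (h ∘ g) P
Img-∘-cong h (f⊆g , g⊆f) = post f⊆g , post g⊆f
  where
  post : ∀ {f g P} → Img f P ⊆ Img g P → Img (h ∘ f) P ⊆ Img (h ∘ g) P
  post f⊆g (x , px , refl) = let (x′ , px′ , e) = f⊆g (x , px , refl) in x′ , px′ , cong h e

Img-≐-map : ∀ {P : Pred F81 0ℓ} {xs} f → P ≐ (_∈ xs) → Img f P ≐ (_∈ map f xs)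
Img-≐-map f (P⊆xs , xs⊆P) =
  (λ { (x , px , refl) → ∈-map⁺ f (P⊆xs px) }) ,
  (λ y∈ → let (x , x∈ , e) = ∈-map⁻ f y∈ in x , xs⊆P x∈ , e)

Img-≐? : ∀ {P : Pred F81 0ℓ} xs → P ≐ (_∈ xs) → ∀ f g → Dec (Img f P ≐ Img g P)
Img-≐? xs P≐xs f g =
  map′ (λ fg → ≐-trans (Img-≐-map f P≐xs) (≐-trans fg (≐-sym (Img-≐-map g P≐xs))))
       (λ fg → ≐-trans (≐-sym (Img-≐-map f P≐xs)) (≐-trans fg (Img-≐-map g P≐xs)))
       (map f xs ⊆? map g xs ×-dec map g xs ⊆? map f xs)
  where open import Data.List.Relation.Binary.Subset.DecPropositional _≟_ using (_⊆?_)

C9-list : F81 → F81 → List F81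
C9-list δ α = 0F ∷ 1F ∷ δ ∷ (α + δ ^ 5) * 1F ∷ (α + δ ^ 5) * δ ∷ []

C9≐C9-list : ∀ δ α → C9 δ α ≐ (_∈ C9-list δ α)
C9≐C9-list δ α = to , from
  where
  to : C9 δ α ⊆ (_∈ C9-list δ α)
  to (inj₁ e)                      = here e
  to (inj₂ (inj₁ e))               = there (here e)
  to (inj₂ (inj₂ (inj₁ e)))        = there (there (here e))
  to (inj₂ (inj₂ (inj₂ (inj₁ e)))) = there (there (there (here e)))
  to (inj₂ (inj₂ (inj₂ (inj₂ e)))) = there (there (there (there (here e))))
  from : (_∈ C9-list δ α) ⊆ C9 δ α
  from (here e)                                 = inj₁ e
  from (there (here e))                         = inj₂ (inj₁ e)
  from (there (there (here e)))                 = inj₂ (inj₂ (inj₁ e))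
  from (there (there (there (here e))))         = inj₂ (inj₂ (inj₂ (inj₁ e)))
  from (there (there (there (there (here e))))) = inj₂ (inj₂ (inj₂ (inj₂ e)))

Powers₁₂₅₆ : F81 → Pred F81 0ℓ
Powers₁₂₅₆ δ x = x ≡ δ ⊎ x ≡ δ ^ 2 ⊎ x ≡ δ ^ 5 ⊎ x ≡ δ ^ 6

ShiftedSquares : F81 → F81 → Set
ShiftedSquares δ α = ∀ x → (InF9 x × S (x + α)) ⇔ Powers₁₂₅₆ δ x

δ²≡δ+1-or-refuted : ∀ α → let δ = α * α in
  δ * δ ≡ δ + 1F ⊎ ¬ InF9 δ ⊎ ∃ λ x → InF9 x × S (x + α) × ¬ Powers₁₂₅₆ δ x
δ²≡δ+1-or-refuted = from-yes (∀? λ α → let δ = α * α in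
  δ * δ ≟ δ + 1F ⊎-dec ¬? (InF9? δ) ⊎-dec
  ∃? λ x → InF9? x ×-dec S? (x + α) ×-dec
           ¬? (x ≟ δ ⊎-dec x ≟ δ ^ 2 ⊎-dec x ≟ δ ^ 5 ⊎-dec x ≟ δ ^ 6))

shifted-squares⇒δ²≡δ+1 : ∀ α → let δ = α * α in ShiftedSquares δ α → δ * δ ≡ δ + 1F
shifted-squares⇒δ²≡δ+1 α h = case δ²≡δ+1-or-refuted α of λ where
  (inj₁ δ²≡δ+1)                         → δ²≡δ+1
  (inj₂ (inj₁ δ∉F₉))                    → ⊥-elim (δ∉F₉ (proj₁ (Equivalence.from (h (α * α)) (inj₁ refl))))
  (inj₂ (inj₂ (x , x∈F₉ , Sx+α , x∉))) → ⊥-elim (x∉ (Equivalence.to (h x) (x∈F₉ , Sx+α)))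

frobenius-C9 : ∀ α → let δ = α * α ; u = α + δ ^ 5 in δ * δ ≡ δ + 1F → ∀ k →
  Img (frob (suc (suc k))) (C9 δ α) ≐ Img (λ x → frob (suc (suc k)) u * x ^ (3 ℕ.^ toℕ k)) (C9 δ α)
frobenius-C9 = from-yes (∀? λ α → let δ = α * α ; u = α + δ ^ 5 in
  δ * δ ≟ δ + 1F →-dec Fin.all? λ k →
  Img-≐? (C9-list δ α) (C9≐C9-list δ α)
    (frob (suc (suc k))) (λ x → frob (suc (suc k)) u * x ^ (3 ℕ.^ toℕ k)))

InOrbit : F81 → F81 → Pred F81 0ℓ → Set
InOrbit δ α D = ∃ λ a → ∃ λ b → ∃ λ (v : Fin 4) → S a × D ≐ Img (λ c → a * frob v c + b) (C9 δ α)

IsCη : F81 → F81 → ℕ → Pred F81 0ℓ → Set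
IsCη δ α η D = ∃ λ s → ∃ λ γ → S s × D ≐ Cη δ α η s γ

frobenius-orbit : ∀ α {D} → let δ = α * α ; u = α + δ ^ 5 in δ * δ ≡ δ + 1F → S u → ∀ k a b → S a →
  D ≐ Img (λ c → a * frob (suc (suc k)) c + b) (C9 δ α) → IsCη δ α (3 ℕ.^ toℕ k) D
frobenius-orbit α δ²≡δ+1 u∈S k a b a∈S D≐ =
  a * frob v u , b , S-* a∈S (S-^ u∈S (3 ℕ.^ toℕ v)) ,
  ≐-trans D≐ (≐-trans (Img-∘-cong (λ w → a * w + b) (frobenius-C9 α δ²≡δ+1 k))
                      (Img-cong λ x → cong (_+ b) (sym (*-assoc a (frob v u) (x ^ (3 ℕ.^ toℕ k))))))
  where
  v : Fin 4
  v = suc (suc k)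
  u : F81
  u = α + (α * α) ^ 5

lemma3p2 : (δ α : F81) → PrimitiveF9 δ → α * α ≡ δ →
    (∀ x → (InF9 x × S (x + α)) ⇔ (x ≡ δ ⊎ x ≡ δ ^ 2 ⊎ x ≡ δ ^ 5 ⊎ x ≡ δ ^ 6)) →
    (D : Pred F81 0ℓ) →
      (∃ λ a → ∃ λ b → ∃ λ (v : Fin 4) → S a × D ≐ Img (λ c → a * frob v c + b) (C9 δ α))
      ⇔ ((∃ λ s → ∃ λ γ → S s × D ≐ Cη δ α 1 s γ) ⊎ (∃ λ s → ∃ λ γ → S s × D ≐ Cη δ α 3 s γ))
lemma3p2 .(α * α) α _ refl shifted D = mk⇔ to from
  where
  δ²≡δ+1 : (α * α) * (α * α) ≡ α * α + 1F
  δ²≡δ+1 = shifted-squares⇒δ²≡δ+1 α shifted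
  u∈S : S (α + (α * α) ^ 5)
  u∈S = subst S (+-comm ((α * α) ^ 5) α)
              (proj₂ (Equivalence.from (shifted ((α * α) ^ 5)) (inj₂ (inj₂ (inj₁ refl)))))
  to : InOrbit (α * α) α D → IsCη (α * α) α 1 D ⊎ IsCη (α * α) α 3 D
  to (a , b , zero , a∈S , D≐)       = inj₁ (a , b , a∈S , D≐)
  to (a , b , suc zero , a∈S , D≐)   = inj₂ (a , b , a∈S , D≐)
  to (a , b , suc (suc zero) , a∈S , D≐) =
    inj₁ (frobenius-orbit α δ²≡δ+1 u∈S zero a b a∈S D≐)
  to (a , b , suc (suc (suc zero)) , a∈S , D≐) =
    inj₂ (frobenius-orbit α δ²≡δ+1 u∈S (suc zero) a b a∈S D≐)
  from : IsCη (α * α) α 1 D ⊎ IsCη (α * α) α 3 D → InOrbit (α * α) α D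
  from (inj₁ (s , γ , s∈S , D≐)) = s , γ , zero , s∈S , D≐
  from (inj₂ (s , γ , s∈S , D≐)) = s , γ , suc zero , s∈S , D≐
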